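{- Suppose that for some $n \geq 0$ the block $s(n), s(n+1), \ldots, s(n+2p+q-1)$ of $2p+q$ consecutive terms of the infinity series has the form $xyx$, where $x$ is a block of length $p \geq 1$ and $y$ is a block of length $q \geq 0$ (i.e., $s(n+t) = s(n+p+q+t)$ for all $0 \leq t < p$). Then $q \geq 2p$. In particular, the infinity series contains no two consecutive identical nonempty blocks.
   Context: The infinity series $(s(n))_{n \geq 0}$ is the integer sequence defined by $s(0)=0$, $s(2n) = -s(n)$ for $n \geq 1$, and $s(2n+1) = s(n)+1$ for $n \geq 0$. A block is a finite list of consecutive terms of the sequence; $xyx$ denotes concatenation of blocks, and $|x|$ is the length of $x$. -}

module Defs where

open import Data.Nat using (ℕ; zero; suc; _/_; _%_)
open import Data.Integer using (ℤ; -_; _+_) renaming (+_ to ⁺_)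

-- With fuel ≥ n the recursion s(2m) = -s(m) (m ≥ 1), s(2m+1) = s(m)+1, s(0)=0
-- is fully unfolded (each step halves n, and n/2 < n for n ≥ 1).
sAux : ℕ → ℕ → ℤ
sAux zero    n = ⁺ 0
sAux (suc f) zero = ⁺ 0
sAux (suc f) (suc k) with (suc k) % 2
... | zero  = - sAux f ((suc k) / 2)
... | suc _ = sAux f ((suc k) / 2) + ⁺ 1

s : ℕ → ℤ
s n = sAux n n

-- Write σ(i) = s(i) + s(i + 1). Neighbouring terms of s differ, which makes
-- σ(2k) = 1 ≠ σ(2k + 1); so at odd distance d a block of length ≥ 2 cannot recur,
-- and a block of length 1 recurs only if d ≥ 3. At even distance 2e, the terms of
-- the block at even positions determine, through s(2m) = -s(m) and s(2m+1) = s(m) + 1,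
-- a block of length ⌈p/2⌉ recurring at distance e. Strong induction on the distance
-- d = p + q then gives d ≥ 3p.
module Submission where

open import Defs
open import Data.Nat
  using (ℕ; zero; suc; _+_; _*_; _≤_; _<_; z≤n; s≤s; _/_; _%_; ⌈_/2⌉)
open import Data.Nat.Properties
  using (≤-refl; ≤-trans; +-suc; +-comm; m≤m+n; m≤n+m; +-mono-≤; +-cancelˡ-≤;
         *-distribˡ-+; *-monoʳ-≤; module ≤-Reasoning; ⌈n/2⌉-mono; n≡⌈n+n/2⌉; ⌊n/2⌋≤⌈n/2⌉; ⌊n/2⌋+⌈n/2⌉≡n)
open import Data.Nat.DivMod using (m/n<m; [m+n]%n≡m%n; m/n≡1+[m∸n]/n)
open import Data.Nat.Induction using (<-rec)
import Data.Nat.Tactic.RingSolver as ℕ-Solver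
open import Data.Integer using (ℤ; -_; -[1+_]; _-_; 0ℤ; 1ℤ) renaming (+_ to ⁺_; _+_ to _⊕_)
import Data.Integer.Properties as ℤ
open import Data.Integer.Tactic.RingSolver using (solve-∀)
open import Data.Empty using (⊥-elim)
open import Data.Product using (Σ; _,_; proj₂)
open import Relation.Binary.PropositionalEquality
open import Algebra.Properties.AbelianGroup ℤ.+-0-abelianGroup using (∙-cancelʳ)

data ParityView : ℕ → Set where
  even : ∀ k → ParityView (k + k)
  odd  : ∀ k → ParityView (suc (k + k))

parityView : ∀ n → ParityView n
parityView zero = even zero
parityView (suc n) with parityView n
... | even k = odd k
... | odd k  = subst ParityView (cong suc (+-suc k k)) (even (suc k))

%2-suc-suc : ∀ n → suc (suc n) % 2 ≡ n % 2
%2-suc-suc n = subst (λ m → m % 2 ≡ n % 2) (+-comm n 2) ([m+n]%n≡m%n n 2)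

/2-suc-suc : ∀ n → suc (suc n) / 2 ≡ suc (n / 2)
/2-suc-suc n = m/n≡1+[m∸n]/n {suc (suc n)} (s≤s (s≤s z≤n))

[k+k]%2≡0 : ∀ k → (k + k) % 2 ≡ 0
[k+k]%2≡0 zero = refl
[k+k]%2≡0 (suc k) rewrite +-suc k k = trans (%2-suc-suc (k + k)) ([k+k]%2≡0 k)

[1+k+k]%2≡1 : ∀ k → suc (k + k) % 2 ≡ 1
[1+k+k]%2≡1 zero = refl
[1+k+k]%2≡1 (suc k) rewrite +-suc k k = trans (%2-suc-suc (suc (k + k))) ([1+k+k]%2≡1 k)

[k+k]/2≡k : ∀ k → (k + k) / 2 ≡ k
[k+k]/2≡k zero = refl
[k+k]/2≡k (suc k) rewrite +-suc k k = trans (/2-suc-suc (k + k)) (cong suc ([k+k]/2≡k k))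

[1+k+k]/2≡k : ∀ k → suc (k + k) / 2 ≡ k
[1+k+k]/2≡k zero = refl
[1+k+k]/2≡k (suc k) rewrite +-suc k k = trans (/2-suc-suc (suc (k + k))) (cong suc ([1+k+k]/2≡k k))

[1+n]/2≤m : ∀ {n m} → n ≤ m → suc n / 2 ≤ m
[1+n]/2≤m {n} n≤m with m/n<m (suc n) 2 (s≤s (s≤s z≤n))
... | s≤s le = ≤-trans le n≤m

sAux-even : ∀ f n → suc n % 2 ≡ 0 → sAux (suc f) (suc n) ≡ - sAux f (suc n / 2)
sAux-even f n eq with suc n % 2 | eq
... | .0 | refl = refl

sAux-odd : ∀ f n → suc n % 2 ≡ 1 → sAux (suc f) (suc n) ≡ sAux f (suc n / 2) ⊕ 1ℤ
sAux-odd f n eq with suc n % 2 | eq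
... | .1 | refl = refl

sAux-fuel-irrelevant : ∀ f g n → n ≤ f → n ≤ g → sAux f n ≡ sAux g n
sAux-fuel-irrelevant zero    zero    zero    _ _ = refl
sAux-fuel-irrelevant zero    (suc g) zero    _ _ = refl
sAux-fuel-irrelevant (suc f) zero    zero    _ _ = refl
sAux-fuel-irrelevant (suc f) (suc g) zero    _ _ = refl
sAux-fuel-irrelevant (suc f) (suc g) (suc n) (s≤s n≤f) (s≤s n≤g) with suc n % 2
... | zero  = cong -_ (sAux-fuel-irrelevant f g _ ([1+n]/2≤m n≤f) ([1+n]/2≤m n≤g))
... | suc _ = cong (_⊕ 1ℤ) (sAux-fuel-irrelevant f g _ ([1+n]/2≤m n≤f) ([1+n]/2≤m n≤g))

s-even : ∀ k → s (k + k) ≡ - s k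
s-even zero = refl
s-even (suc k) = begin
  s (suc k + suc k)
    ≡⟨ sAux-even (k + suc k) (k + suc k) ([k+k]%2≡0 (suc k)) ⟩
  - sAux (k + suc k) ((suc k + suc k) / 2)
    ≡⟨ cong (λ m → - sAux (k + suc k) m) ([k+k]/2≡k (suc k)) ⟩
  - sAux (k + suc k) (suc k)
    ≡⟨ cong -_ (sAux-fuel-irrelevant _ _ (suc k) (m≤n+m (suc k) k) ≤-refl) ⟩
  - s (suc k)
    ∎
  where open ≡-Reasoning

s-odd : ∀ k → s (suc (k + k)) ≡ s k ⊕ 1ℤ
s-odd k = begin
  s (suc (k + k))
    ≡⟨ sAux-odd (k + k) (k + k) ([1+k+k]%2≡1 k) ⟩
  sAux (k + k) (suc (k + k) / 2) ⊕ 1ℤ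
    ≡⟨ cong (λ m → sAux (k + k) m ⊕ 1ℤ) ([1+k+k]/2≡k k) ⟩
  sAux (k + k) k ⊕ 1ℤ
    ≡⟨ cong (_⊕ 1ℤ) (sAux-fuel-irrelevant _ _ k (m≤m+n k k) ≤-refl) ⟩
  s k ⊕ 1ℤ
    ∎
  where open ≡-Reasoning

s-even-suc : ∀ k → s (suc (suc (k + k))) ≡ - s (suc k)
s-even-suc k = trans (cong s (cong suc (sym (+-suc k k)))) (s-even (suc k))

s-even-injective : ∀ a c → s (a + a) ≡ s (c + c) → s a ≡ s c
s-even-injective a c eq = ℤ.neg-injective (trans (sym (s-even a)) (trans eq (s-even c)))

s-odd-injective : ∀ a c → s (suc (a + a)) ≡ s (suc (c + c)) → s a ≡ s c
s-odd-injective a c eq = ∙-cancelʳ 1ℤ (s a) (s c) (trans (sym (s-odd a)) (trans eq (s-odd c)))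

k+k≢1+j+j : ∀ k j → k + k ≢ suc (j + j)
k+k≢1+j+j k j eq with trans (sym ([k+k]%2≡0 k)) (trans (cong (_% 2) eq) ([1+k+k]%2≡1 j))
... | ()

-- a ≢ b is not preserved by (a , b) ↦ (a + 1 , - b), which takes (s k , s (k + 1))
-- to (s (2k + 1) , s (2k + 2)); this strengthening is.
data Separated : ℤ → ℤ → Set where
  odd-sum           : ∀ {a b} k → a ⊕ b ≡ ⁺ suc (k + k) → Separated a b
  positive-even-gap : ∀ {a b} k → a - b ≡ ⁺ suc (suc (k + k)) → Separated a b

Separated⇒≢ : ∀ {a b} → Separated a b → a ≢ b
Separated⇒≢ {⁺ n}      (odd-sum k eq) refl = k+k≢1+j+j n k (ℤ.+-injective eq)
Separated⇒≢ { -[1+ n ]} (odd-sum k ()) refl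
Separated⇒≢ {a} (positive-even-gap k eq) refl with trans (sym (ℤ.+-inverseʳ a)) eq
... | ()

Separated-step : ∀ {a b} → Separated a b → Separated (a ⊕ 1ℤ) (- b)
Separated-step {a} {b} (odd-sum k eq) = positive-even-gap k (begin
  (a ⊕ 1ℤ) - (- b)    ≡⟨ regroup a b ⟩
  (a ⊕ b) ⊕ 1ℤ        ≡⟨ cong (_⊕ 1ℤ) eq ⟩
  ⁺ (suc (k + k) + 1) ≡⟨ cong ⁺_ (+-comm (suc (k + k)) 1) ⟩
  ⁺ suc (suc (k + k)) ∎)
  where
  open ≡-Reasoning
  regroup : ∀ x y → (x ⊕ 1ℤ) - (- y) ≡ (x ⊕ y) ⊕ 1ℤ
  regroup = solve-∀
Separated-step {a} {b} (positive-even-gap k eq) = odd-sum (suc k) (begin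
  (a ⊕ 1ℤ) ⊕ (- b)          ≡⟨ regroup a b ⟩
  (a - b) ⊕ 1ℤ              ≡⟨ cong (_⊕ 1ℤ) eq ⟩
  ⁺ (suc (suc (k + k)) + 1) ≡⟨ cong ⁺_ (+-comm (suc (suc (k + k))) 1) ⟩
  ⁺ suc (suc (suc (k + k))) ≡⟨ cong (λ m → ⁺ suc (suc m)) (sym (+-suc k k)) ⟩
  ⁺ suc (suc k + suc k)     ∎)
  where
  open ≡-Reasoning
  regroup : ∀ x y → (x ⊕ 1ℤ) ⊕ (- y) ≡ (x - y) ⊕ 1ℤ
  regroup = solve-∀

pairSum : ℕ → ℤ
pairSum n = s n ⊕ s (suc n)

pairSum-even : ∀ k → pairSum (k + k) ≡ 1ℤ
pairSum-even k = trans (cong₂ _⊕_ (s-even k) (s-odd k)) (cancel (s k))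
  where
  cancel : ∀ x → - x ⊕ (x ⊕ 1ℤ) ≡ 1ℤ
  cancel = solve-∀

s-neighbours-separated : ∀ n → Separated (s n) (s (suc n))
s-neighbours-separated = <-rec (λ n → Separated (s n) (s (suc n))) step
  where
  step : ∀ n → (∀ {m} → m < n → Separated (s m) (s (suc m))) → Separated (s n) (s (suc n))
  step n rec with parityView n
  ... | even k = odd-sum 0 (pairSum-even k)
  ... | odd k  = subst₂ Separated (sym (s-odd k)) (sym (s-even-suc k))
                   (Separated-step (rec (s≤s (m≤m+n k k))))

s-suc-≢ : ∀ n → s n ≢ s (suc n)
s-suc-≢ n = Separated⇒≢ (s-neighbours-separated n)

pairSum-odd≢1 : ∀ k → pairSum (suc (k + k)) ≢ 1ℤ
pairSum-odd≢1 k eq = s-suc-≢ k (ℤ.i-j≡0⇒i≡j _ _ (∙-cancelʳ 1ℤ _ 0ℤ (begin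
  (s k - s (suc k)) ⊕ 1ℤ       ≡⟨ regroup (s k) (s (suc k)) ⟩
  (s k ⊕ 1ℤ) ⊕ - s (suc k)     ≡⟨ cong₂ _⊕_ (sym (s-odd k)) (sym (s-even-suc k)) ⟩
  pairSum (suc (k + k))        ≡⟨ eq ⟩
  1ℤ                           ∎)))
  where
  open ≡-Reasoning
  regroup : ∀ x y → (x - y) ⊕ 1ℤ ≡ (x ⊕ 1ℤ) ⊕ - y
  regroup = solve-∀

-- Whichever of i, i + d is even has pair sum 1, the other one does not.
pairSum-≢-at-odd-distance : ∀ i e → pairSum i ≢ pairSum (i + suc (e + e))
pairSum-≢-at-odd-distance i e eq with parityView i
... | even j = pairSum-odd≢1 (j + e)
                 (subst (λ m → pairSum m ≡ 1ℤ) (shift j e) (trans (sym eq) (pairSum-even j)))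
  where
  shift : ∀ j e → j + j + suc (e + e) ≡ suc ((j + e) + (j + e))
  shift = ℕ-Solver.solve-∀
... | odd j  = pairSum-odd≢1 j
                 (trans eq (subst (λ m → pairSum m ≡ 1ℤ) (sym (shift j e)) (pairSum-even (suc (j + e)))))
  where
  shift : ∀ j e → suc (j + j) + suc (e + e) ≡ suc (j + e) + suc (j + e)
  shift = ℕ-Solver.solve-∀

-- Indices are written t + n so that t = 0, 1 give s n, s (suc n) on the nose.
Recurs : ℕ → ℕ → ℕ → Set
Recurs n d p = ∀ t → t < p → s (t + n) ≡ s (t + n + d)

t<⌈p/2⌉⇒t+t<p : ∀ p {t} → t < ⌈ p /2⌉ → t + t < p
t<⌈p/2⌉⇒t+t<p (suc zero)    {zero}  _        = s≤s z≤n
t<⌈p/2⌉⇒t+t<p (suc zero)    {suc t} (s≤s ())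
t<⌈p/2⌉⇒t+t<p (suc (suc p)) {zero}  _        = s≤s z≤n
t<⌈p/2⌉⇒t+t<p (suc (suc p)) {suc t} (s≤s lt) =
  subst (_< suc (suc p)) (cong suc (sym (+-suc t t))) (s≤s (s≤s (t<⌈p/2⌉⇒t+t<p p lt)))

p≤⌈p/2⌉+⌈p/2⌉ : ∀ p → p ≤ ⌈ p /2⌉ + ⌈ p /2⌉
p≤⌈p/2⌉+⌈p/2⌉ p = subst (_≤ ⌈ p /2⌉ + ⌈ p /2⌉) (⌊n/2⌋+⌈n/2⌉≡n p) (+-mono-≤ (⌊n/2⌋≤⌈n/2⌉ p) ≤-refl)

⌈p/2⌉≤e : ∀ {p} e → p ≤ e + e → ⌈ p /2⌉ ≤ e
⌈p/2⌉≤e e p≤e+e = subst (_ ≤_) (sym (n≡⌈n+n/2⌉ e)) (⌈n/2⌉-mono p≤e+e)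

Recurs-halve : ∀ {n e p} → Recurs n (e + e) p → Σ ℕ λ m → Recurs m e ⌈ p /2⌉
Recurs-halve {n} {e} {p} R with parityView n
... | even m = m , λ t t<p′ →
  s-even-injective (t + m) (t + m + e)
    (subst₂ (λ i j → s i ≡ s j) (left t m) (right t m e) (R (t + t) (t<⌈p/2⌉⇒t+t<p p t<p′)))
  where
  left : ∀ t m → t + t + (m + m) ≡ (t + m) + (t + m)
  left = ℕ-Solver.solve-∀
  right : ∀ t m e → t + t + (m + m) + (e + e) ≡ (t + m + e) + (t + m + e)
  right = ℕ-Solver.solve-∀
... | odd m = m , λ t t<p′ →
  s-odd-injective (t + m) (t + m + e)
    (subst₂ (λ i j → s i ≡ s j) (left t m) (right t m e) (R (t + t) (t<⌈p/2⌉⇒t+t<p p t<p′)))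
  where
  left : ∀ t m → t + t + suc (m + m) ≡ suc ((t + m) + (t + m))
  left = ℕ-Solver.solve-∀
  right : ∀ t m e → t + t + suc (m + m) + (e + e) ≡ suc ((t + m + e) + (t + m + e))
  right = ℕ-Solver.solve-∀

1≤⌈p/2⌉ : ∀ {p} → 1 ≤ p → 1 ≤ ⌈ p /2⌉
1≤⌈p/2⌉ {suc p} _ = s≤s z≤n

recurrence-gap-odd : ∀ e {n p} → 1 ≤ p → Recurs n (suc (e + e)) p → 3 * p ≤ suc (e + e)
recurrence-gap-odd zero    {n} {suc zero}    _ R =
  ⊥-elim (s-suc-≢ n (trans (R 0 (s≤s z≤n)) (cong s (+-comm n 1))))
recurrence-gap-odd (suc e) {_} {suc zero}    _ _ =
  s≤s (s≤s (≤-trans (s≤s z≤n) (m≤n+m (suc e) e)))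
recurrence-gap-odd e       {n} {suc (suc _)} _ R =
  ⊥-elim (pairSum-≢-at-odd-distance n e (cong₂ _⊕_ (R 0 (s≤s z≤n)) (R 1 (s≤s (s≤s z≤n)))))

k<k+k : ∀ {k} → 1 ≤ k → k < k + k
k<k+k {suc k} _ = s≤s (subst (k <_) (sym (+-suc k k)) (s≤s (m≤m+n k k)))

recurrence-gap : ∀ d {n p} → 1 ≤ p → p ≤ d → Recurs n d p → 3 * p ≤ d
recurrence-gap = <-rec P step
  where
  P : ℕ → Set
  P d = ∀ {n p} → 1 ≤ p → p ≤ d → Recurs n d p → 3 * p ≤ d
  step : ∀ d → (∀ {d′} → d′ < d → P d′) → P d
  step d rec {p = p} 1≤p p≤d R with parityView d
  ... | odd e  = recurrence-gap-odd e 1≤p R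
  ... | even zero with ≤-trans 1≤p p≤d
  ...   | ()
  step d rec {p = p} 1≤p p≤d R | even e@(suc _) = begin
    3 * p                     ≤⟨ *-monoʳ-≤ 3 (p≤⌈p/2⌉+⌈p/2⌉ p) ⟩
    3 * (⌈ p /2⌉ + ⌈ p /2⌉)   ≡⟨ *-distribˡ-+ 3 ⌈ p /2⌉ ⌈ p /2⌉ ⟩
    3 * ⌈ p /2⌉ + 3 * ⌈ p /2⌉ ≤⟨ +-mono-≤ half-gap half-gap ⟩
    e + e                     ∎
    where
    open ≤-Reasoning
    half-gap : 3 * ⌈ p /2⌉ ≤ e
    half-gap = rec (k<k+k (s≤s z≤n)) (1≤⌈p/2⌉ 1≤p) (⌈p/2⌉≤e e p≤d) (proj₂ (Recurs-halve R))

theorem10 : (n p q : ℕ) → 1 ≤ p →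
    ((t : ℕ) → t < p → s (n + t) ≡ s (n + p + q + t)) →
    2 * p ≤ q
theorem10 n p q 1≤p xyx = +-cancelˡ-≤ p (2 * p) q
  (recurrence-gap (p + q) 1≤p (m≤m+n p q) λ t t<p →
    subst₂ (λ i j → s i ≡ s j) (+-comm n t) (reorder n p q t) (xyx t t<p))
  where
  reorder : ∀ n p q t → n + p + q + t ≡ t + n + (p + q)
  reorder = ℕ-Solver.solve-∀
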